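{- Let $m\ge 1$ and $s\ge 0$ be integers with $s<s_0:=\frac{1+\sqrt{1+8m}}{2}$. Let $G$ be the bipartite graph with parts $B=\{b_1,\dots,b_m\}$ and $R=\{r_1,\dots,r_{m+s}\}$ whose edges are: (i) $b_ir_i$ for every $i\in\{1,\dots,m\}$; and (ii) if $2\le s$, for every $2$-subset $\{i,j\}$ of $\{1,\dots,s\}$ the edges $b_{\phi(\{i,j\})}r_{m+i}$ and $b_{\phi(\{i,j\})}r_{m+j}$, where $\phi$ is a fixed injective function from the set of $2$-subsets of $\{1,\dots,s\}$ to $\{1,\dots,m\}$ (which exists since $s<s_0$ implies $\binom{s}{2}<m$). Let $\mathcal R$ be the set of $2$-subsets $A$ of $V(G)$ with $|R\cap A|$ odd. Then $\beta(F_2(G))=|\mathcal R|$.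
   Context: For a simple finite graph $G$, the $2$-token graph $F_2(G)$ is the graph whose vertices are all $2$-element subsets of $V(G)$, two such subsets being adjacent iff their symmetric difference is an edge of $G$. $\beta$ denotes the independence number. -}

module Defs where

open import Data.Nat using (ℕ; zero; suc; _+_; _*_; _≤_; _%_; _<?_)
open import Data.Sum using (_⊎_)
open import Relation.Nullary using (yes; no)
open import Data.Nat.Properties using (_≟_)
open import Data.Fin using (Fin; _↑ˡ_; _↑ʳ_; toℕ)
open import Data.Fin.Subset using (Subset; ⁅_⁆; _∪_; _∩_; _─_; ∣_∣; _∈_; inside; outside)
open import Data.Vec using (Vec; []; _∷_; tabulate)
open import Data.List using (List; []; _∷_; map; _++_; filter; length; concatMap)
open import Data.List.Relation.Unary.All using (All)
open import Data.List.Relation.Unary.Unique.Propositional using (Unique)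
open import Data.List.Membership.Propositional using () renaming (_∈_ to _∈ₗ_)
open import Data.Product using (Σ; ∃; ∃₂; _×_; _,_; proj₁)
open import Data.Bool using (Bool; true; false)
open import Relation.Binary.PropositionalEquality using (_≡_)
open import Relation.Nullary using (¬_)
open import Relation.Nullary.Decidable using (_×-dec_)

_⊝_ : ∀ {n} → Subset n → Subset n → Subset n
A ⊝ B = (A ─ B) ∪ (B ─ A)

allSubsets : (n : ℕ) → List (Subset n)
allSubsets zero = [] ∷ []
allSubsets (suc n) = map (true ∷_) (allSubsets n) ++ map (false ∷_) (allSubsets n)

TokenAdj : ∀ {n} → (Fin n → Fin n → Set) → Subset n → Subset n → Set
TokenAdj E A B = ∃₂ λ u v → E u v × (A ⊝ B ≡ ⁅ u ⁆ ∪ ⁅ v ⁆)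

Independent₂ : ∀ {n} → (Fin n → Fin n → Set) → List (Subset n) → Set
Independent₂ E I =
  All (λ A → ∣ A ∣ ≡ 2) I × Unique I ×
  (∀ {A B} → A ∈ₗ I → B ∈ₗ I → ¬ TokenAdj E A B)

IsIndependenceNumber₂ : ∀ {n} → (Fin n → Fin n → Set) → ℕ → Set
IsIndependenceNumber₂ E k =
  (∃ λ I → Independent₂ E I × length I ≡ k) ×
  (∀ I → Independent₂ E I → length I ≤ k)

TwoSubset : ℕ → Set
TwoSubset s = Σ (Subset s) (λ P → ∣ P ∣ ≡ 2)

module Construction (m s : ℕ) (φ : TwoSubset s → Fin m) where

  -- vertex set: Fin (m + (m + s)); the first m are B, the remaining m + s are R
  N : ℕ
  N = m + (m + s)

  b : Fin m → Fin N
  b i = i ↑ˡ (m + s)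

  r : Fin (m + s) → Fin N
  r j = m ↑ʳ j

  rlow : Fin m → Fin N
  rlow i = r (i ↑ˡ s)

  rhigh : Fin s → Fin N
  rhigh i = r (m ↑ʳ i)

  data Edge₀ : Fin N → Fin N → Set where
    matching : (i : Fin m) → Edge₀ (b i) (rlow i)
    gadget   : (P : TwoSubset s) (i : Fin s) → i ∈ proj₁ P → Edge₀ (b (φ P)) (rhigh i)

  Edge : Fin N → Fin N → Set
  Edge u v = Edge₀ u v ⊎ Edge₀ v u

  Rset : Subset N
  Rset = tabulate (λ v → isR v)
    where
      isR : Fin N → Bool
      isR v with toℕ v <? m
      ... | yes _ = false
      ... | no _ = true

  𝓡 : List (Subset N)
  𝓡 = filter (λ A → (∣ A ∣ ≟ 2) ×-dec (∣ Rset ∩ A ∣ % 2 ≟ 1)) (allSubsets N)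

module Submission where

-- Every edge of G joins B to R, and |R ∩ A| + |R ∩ A′| ≡ |R ∩ (A ⊝ A′)| mod 2; so if A and A′
-- are adjacent in F₂(G) exactly one of |R ∩ A|, |R ∩ A′| is odd, and 𝓡 is independent.
-- Conversely every 2-set outside 𝓡 lies inside B or inside R and is matched injectively to an
-- adjacent member of 𝓡: for i < j, {b_i, b_j} ↦ {b_j, r_i} and {r_i, r_j} ↦ {b_i, r_j};
-- {r_{m+k}, r_{m+l}} ↦ {b_φ{k,l}, r_{m+l}} for k < l; and {r_x, r_{m+l}} ↦ {b_x, r_x} when
-- b_x = b_φ{k,l} for some k < l, and ↦ {b_x, r_{m+l}} otherwise. Sending each member of an
-- independent set to itself or to its partner is injective into 𝓡, since two members can only
-- collide when they are adjacent.

open import Defs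
open import Data.Nat using (ℕ; zero; suc; _+_; _*_; _∸_; _<_; _≤_; _%_)
import Data.Nat.Properties as ℕ
open import Data.Nat.DivMod using (%-distribˡ-+; [m+kn]%n≡m%n)
open import Data.Fin as Fin using (Fin; zero; suc; toℕ; join; splitAt)
open import Data.Fin.Properties
  using (_≟_; any?; suc-injective; <-irrefl; <-asym; <-cmp; <⇒≢; <-irrelevant; injective⇒≤;
         toℕ<n; toℕ-↑ˡ; toℕ-↑ʳ; splitAt-↑ˡ; splitAt-↑ʳ; splitAt-join; join-splitAt)
open import Data.Fin.Subset using (Subset; ⁅_⁆; _∪_; _∩_; _─_; _⊆_; ∣_∣; _∈_; _∉_; ⊥; inside; outside)
open import Data.Fin.Subset.Properties
  using (x∈⁅x⁆; x∈⁅y⁆⇒x≡y; x∈p∪q⁺; x∈p∪q⁻; x∈p∩q⁺; x∈p∩q⁻; x∈p∧x∉q⇒x∈p─q; ⊆-antisym;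
         ∣⁅x⁆∣≡1; ∪-identityˡ; ∪-identityʳ; ∪-comm)
open import Data.Vec using ([]; _∷_; lookup; here; there)
open import Data.Vec.Properties using (∷-injectiveʳ; lookup∘tabulate; lookup⇒[]=; []=⇒lookup)
open import Data.List using (List; _∷_; length; map)
import Data.List as List
open import Data.List.Relation.Unary.All as All using ([])
open import Data.List.Relation.Unary.Any as Any using (here)
open import Data.List.Relation.Unary.Any.Properties using (lookup-index)
open import Data.List.Relation.Unary.AllPairs using ([]; _∷_)
open import Data.List.Relation.Unary.Unique.Propositional using (Unique)
import Data.List.Relation.Unary.Unique.Propositional.Properties as Unique
open import Data.List.Membership.Propositional using () renaming (_∈_ to _∈ₗ_)
open import Data.List.Membership.Propositional.Properties
  using (∈-lookup; ∈-filter⁺; ∈-filter⁻; ∈-map⁺; ∈-map⁻; ∈-++⁺ˡ; ∈-++⁺ʳ)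
open import Data.Product using (_×_; _,_; ∃; ∃₂; proj₁; proj₂)
open import Data.Sum using (_⊎_; inj₁; inj₂; [_,_]′)
open import Data.Empty using (⊥-elim)
open import Function using (_∘_; _∋_; case_of_)
open import Relation.Nullary using (¬_; Dec; yes; no)
open import Relation.Nullary.Decidable using (_×-dec_)
open import Relation.Binary.Definitions using (tri<; tri≈; tri>)
open import Relation.Binary.PropositionalEquality

private variable
  n : ℕ
  x y z u v : Fin n
  p : Subset n

x∈p─q⁻ : ∀ (p q : Subset n) → x ∈ p ─ q → x ∈ p × x ∉ q
x∈p─q⁻ (inside ∷ p) (outside ∷ q) here = here , λ ()
x∈p─q⁻ {x = zero} (outside ∷ p) (inside ∷ q) ()
x∈p─q⁻ {x = zero} (outside ∷ p) (outside ∷ q) ()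
x∈p─q⁻ (_ ∷ p) (_ ∷ q) (there x∈p─q) with x∈p─q⁻ p q x∈p─q
... | x∈p , x∉q = there x∈p , λ { (there x∈q) → x∉q x∈q }

x∈⁅x⁆∪⁅y⁆ : ∀ (x y : Fin n) → x ∈ ⁅ x ⁆ ∪ ⁅ y ⁆
x∈⁅x⁆∪⁅y⁆ x y = x∈p∪q⁺ (inj₁ (x∈⁅x⁆ x))

y∈⁅x⁆∪⁅y⁆ : ∀ (x y : Fin n) → y ∈ ⁅ x ⁆ ∪ ⁅ y ⁆
y∈⁅x⁆∪⁅y⁆ x y = x∈p∪q⁺ (inj₂ (x∈⁅x⁆ y))

x∈⁅y⁆∪⁅z⁆⁻ : x ∈ ⁅ y ⁆ ∪ ⁅ z ⁆ → x ≡ y ⊎ x ≡ z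
x∈⁅y⁆∪⁅z⁆⁻ {y = y} {z} x∈ with x∈p∪q⁻ ⁅ y ⁆ ⁅ z ⁆ x∈
... | inj₁ x∈⁅y⁆ = inj₁ (x∈⁅y⁆⇒x≡y y x∈⁅y⁆)
... | inj₂ x∈⁅z⁆ = inj₂ (x∈⁅y⁆⇒x≡y z x∈⁅z⁆)

x∉⁅y⁆∪⁅z⁆ : x ≢ y → x ≢ z → x ∉ ⁅ y ⁆ ∪ ⁅ z ⁆
x∉⁅y⁆∪⁅z⁆ x≢y x≢z x∈ with x∈⁅y⁆∪⁅z⁆⁻ x∈
... | inj₁ x≡y = x≢y x≡y
... | inj₂ x≡z = x≢z x≡z

⁅x⁆∪⁅y⁆≡⁅u⁆∪⁅v⁆⁻ : ⁅ x ⁆ ∪ ⁅ y ⁆ ≡ ⁅ u ⁆ ∪ ⁅ v ⁆ → (x ≡ u ⊎ x ≡ v) × (y ≡ u ⊎ y ≡ v)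
⁅x⁆∪⁅y⁆≡⁅u⁆∪⁅v⁆⁻ {x = x} {y} eq =
  x∈⁅y⁆∪⁅z⁆⁻ (subst (x ∈_) eq (x∈⁅x⁆∪⁅y⁆ x y)) , x∈⁅y⁆∪⁅z⁆⁻ (subst (y ∈_) eq (y∈⁅x⁆∪⁅y⁆ x y))

⁅x⁆∪⁅y⁆-injective-< : x Fin.< y → u Fin.< v → ⁅ x ⁆ ∪ ⁅ y ⁆ ≡ ⁅ u ⁆ ∪ ⁅ v ⁆ → x ≡ u × y ≡ v
⁅x⁆∪⁅y⁆-injective-< x<y u<v eq with ⁅x⁆∪⁅y⁆≡⁅u⁆∪⁅v⁆⁻ eq
... | inj₁ x≡u  , inj₂ y≡v  = x≡u , y≡v
... | inj₁ refl , inj₁ refl = ⊥-elim (<-irrefl refl x<y)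
... | inj₂ refl , inj₂ refl = ⊥-elim (<-irrefl refl x<y)
... | inj₂ refl , inj₁ refl = ⊥-elim (<-asym x<y u<v)

[⁅x⁆∪⁅z⁆]⊝[⁅y⁆∪⁅z⁆]≡⁅x⁆∪⁅y⁆ : x ≢ y → x ≢ z → y ≢ z → (⁅ x ⁆ ∪ ⁅ z ⁆) ⊝ (⁅ y ⁆ ∪ ⁅ z ⁆) ≡ ⁅ x ⁆ ∪ ⁅ y ⁆
[⁅x⁆∪⁅z⁆]⊝[⁅y⁆∪⁅z⁆]≡⁅x⁆∪⁅y⁆ {x = x} {y} {z} x≢y x≢z y≢z = ⊆-antisym lhs⊆rhs rhs⊆lhs
  where
  lhs⊆rhs : (⁅ x ⁆ ∪ ⁅ z ⁆) ⊝ (⁅ y ⁆ ∪ ⁅ z ⁆) ⊆ ⁅ x ⁆ ∪ ⁅ y ⁆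
  lhs⊆rhs w∈ with x∈p∪q⁻ _ _ w∈
  ... | inj₁ w∈A─B with x∈p─q⁻ (⁅ x ⁆ ∪ ⁅ z ⁆) _ w∈A─B
  ...   | w∈A , w∉B with x∈⁅y⁆∪⁅z⁆⁻ w∈A
  ...     | inj₁ refl = x∈⁅x⁆∪⁅y⁆ x y
  ...     | inj₂ refl = ⊥-elim (w∉B (y∈⁅x⁆∪⁅y⁆ y z))
  lhs⊆rhs w∈ | inj₂ w∈B─A with x∈p─q⁻ (⁅ y ⁆ ∪ ⁅ z ⁆) _ w∈B─A
  ...   | w∈B , w∉A with x∈⁅y⁆∪⁅z⁆⁻ w∈B
  ...     | inj₁ refl = y∈⁅x⁆∪⁅y⁆ x y
  ...     | inj₂ refl = ⊥-elim (w∉A (y∈⁅x⁆∪⁅y⁆ x z))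
  rhs⊆lhs : ⁅ x ⁆ ∪ ⁅ y ⁆ ⊆ (⁅ x ⁆ ∪ ⁅ z ⁆) ⊝ (⁅ y ⁆ ∪ ⁅ z ⁆)
  rhs⊆lhs w∈ with x∈⁅y⁆∪⁅z⁆⁻ w∈
  ... | inj₁ refl = x∈p∪q⁺ (inj₁ (x∈p∧x∉q⇒x∈p─q (x∈⁅x⁆∪⁅y⁆ x z) (x∉⁅y⁆∪⁅z⁆ x≢y x≢z)))
  ... | inj₂ refl = x∈p∪q⁺ (inj₂ (x∈p∧x∉q⇒x∈p─q (x∈⁅x⁆∪⁅y⁆ y z) (x∉⁅y⁆∪⁅z⁆ (≢-sym x≢y) y≢z)))

p∩[⁅x⁆∪⁅y⁆]≡⁅y⁆ : x ∉ p → y ∈ p → p ∩ (⁅ x ⁆ ∪ ⁅ y ⁆) ≡ ⁅ y ⁆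
p∩[⁅x⁆∪⁅y⁆]≡⁅y⁆ {x = x} {p} {y} x∉p y∈p = ⊆-antisym lhs⊆rhs rhs⊆lhs
  where
  lhs⊆rhs : p ∩ (⁅ x ⁆ ∪ ⁅ y ⁆) ⊆ ⁅ y ⁆
  lhs⊆rhs w∈ with x∈p∩q⁻ p _ w∈
  ... | w∈p , w∈xy with x∈⁅y⁆∪⁅z⁆⁻ w∈xy
  ...   | inj₁ refl = ⊥-elim (x∉p w∈p)
  ...   | inj₂ refl = x∈⁅x⁆ y
  rhs⊆lhs : ⁅ y ⁆ ⊆ p ∩ (⁅ x ⁆ ∪ ⁅ y ⁆)
  rhs⊆lhs w∈ with x∈⁅y⁆⇒x≡y y w∈
  ... | refl = x∈p∩q⁺ (y∈p , y∈⁅x⁆∪⁅y⁆ x y)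

∣⁅x⁆∪⁅y⁆∣≡2 : x ≢ y → ∣ ⁅ x ⁆ ∪ ⁅ y ⁆ ∣ ≡ 2
∣⁅x⁆∪⁅y⁆∣≡2 {x = zero}  {zero}  x≢y = ⊥-elim (x≢y refl)
∣⁅x⁆∪⁅y⁆∣≡2 {x = zero}  {suc y} _   = cong suc (trans (cong ∣_∣ (∪-identityˡ ⁅ y ⁆)) (∣⁅x⁆∣≡1 y))
∣⁅x⁆∪⁅y⁆∣≡2 {x = suc x} {zero}  _   = cong suc (trans (cong ∣_∣ (∪-identityʳ ⁅ x ⁆)) (∣⁅x⁆∣≡1 x))
∣⁅x⁆∪⁅y⁆∣≡2 {x = suc x} {suc y} x≢y = ∣⁅x⁆∪⁅y⁆∣≡2 (x≢y ∘ cong suc)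

∣p∣≡0⇒p≡⊥ : ∀ (p : Subset n) → ∣ p ∣ ≡ 0 → p ≡ ⊥
∣p∣≡0⇒p≡⊥ []            _     = refl
∣p∣≡0⇒p≡⊥ (outside ∷ p) ∣p∣≡0 = cong (outside ∷_) (∣p∣≡0⇒p≡⊥ p ∣p∣≡0)

∣p∣≡1⇒p≡⁅x⁆ : ∀ (p : Subset n) → ∣ p ∣ ≡ 1 → ∃ λ x → p ≡ ⁅ x ⁆
∣p∣≡1⇒p≡⁅x⁆ (inside ∷ p)  ∣p∣≡1 = zero , cong (inside ∷_) (∣p∣≡0⇒p≡⊥ p (ℕ.suc-injective ∣p∣≡1))
∣p∣≡1⇒p≡⁅x⁆ (outside ∷ p) ∣p∣≡1 with ∣p∣≡1⇒p≡⁅x⁆ p ∣p∣≡1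
... | x , p≡⁅x⁆ = suc x , cong (outside ∷_) p≡⁅x⁆

∣p∣≡2⇒p≡⁅x⁆∪⁅y⁆ : ∀ (p : Subset n) → ∣ p ∣ ≡ 2 → ∃₂ λ x y → x ≢ y × p ≡ ⁅ x ⁆ ∪ ⁅ y ⁆
∣p∣≡2⇒p≡⁅x⁆∪⁅y⁆ (inside ∷ p) ∣p∣≡2 with ∣p∣≡1⇒p≡⁅x⁆ p (ℕ.suc-injective ∣p∣≡2)
... | y , p≡⁅y⁆ = zero , suc y , (λ ()) , cong (inside ∷_) (trans p≡⁅y⁆ (sym (∪-identityˡ ⁅ y ⁆)))
∣p∣≡2⇒p≡⁅x⁆∪⁅y⁆ (outside ∷ p) ∣p∣≡2 with ∣p∣≡2⇒p≡⁅x⁆∪⁅y⁆ p ∣p∣≡2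
... | x , y , x≢y , p≡⁅x⁆∪⁅y⁆ = suc x , suc y , x≢y ∘ suc-injective , cong (outside ∷_) p≡⁅x⁆∪⁅y⁆

∣p∩q∣+∣p∩r∣≡∣p∩[q⊝r]∣+∣p∩q∩r∣*2 : ∀ (p q r : Subset n) →
  ∣ p ∩ q ∣ + ∣ p ∩ r ∣ ≡ ∣ p ∩ (q ⊝ r) ∣ + ∣ p ∩ (q ∩ r) ∣ * 2
∣p∩q∣+∣p∩r∣≡∣p∩[q⊝r]∣+∣p∩q∩r∣*2 [] [] [] = refl
∣p∩q∣+∣p∩r∣≡∣p∩[q⊝r]∣+∣p∩q∩r∣*2 (inside ∷ p) (inside ∷ q) (inside ∷ r) = begin
  suc (∣ p ∩ q ∣ + suc ∣ p ∩ r ∣)                    ≡⟨ cong suc (ℕ.+-suc _ _) ⟩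
  suc (suc (∣ p ∩ q ∣ + ∣ p ∩ r ∣))                  ≡⟨ cong (λ k → suc (suc k)) (∣p∩q∣+∣p∩r∣≡∣p∩[q⊝r]∣+∣p∩q∩r∣*2 p q r) ⟩
  suc (suc (∣ p ∩ (q ⊝ r) ∣ + ∣ p ∩ (q ∩ r) ∣ * 2))  ≡⟨ cong suc (ℕ.+-suc ∣ p ∩ (q ⊝ r) ∣ _) ⟨
  suc (∣ p ∩ (q ⊝ r) ∣ + suc (∣ p ∩ (q ∩ r) ∣ * 2))  ≡⟨ ℕ.+-suc ∣ p ∩ (q ⊝ r) ∣ _ ⟨
  ∣ p ∩ (q ⊝ r) ∣ + suc (suc (∣ p ∩ (q ∩ r) ∣ * 2))  ∎
  where open ≡-Reasoning
∣p∩q∣+∣p∩r∣≡∣p∩[q⊝r]∣+∣p∩q∩r∣*2 (inside ∷ p) (inside ∷ q) (outside ∷ r) =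
  cong suc (∣p∩q∣+∣p∩r∣≡∣p∩[q⊝r]∣+∣p∩q∩r∣*2 p q r)
∣p∩q∣+∣p∩r∣≡∣p∩[q⊝r]∣+∣p∩q∩r∣*2 (inside ∷ p) (outside ∷ q) (inside ∷ r) =
  trans (ℕ.+-suc _ _) (cong suc (∣p∩q∣+∣p∩r∣≡∣p∩[q⊝r]∣+∣p∩q∩r∣*2 p q r))
∣p∩q∣+∣p∩r∣≡∣p∩[q⊝r]∣+∣p∩q∩r∣*2 (inside ∷ p) (outside ∷ q) (outside ∷ r) =
  ∣p∩q∣+∣p∩r∣≡∣p∩[q⊝r]∣+∣p∩q∩r∣*2 p q r
∣p∩q∣+∣p∩r∣≡∣p∩[q⊝r]∣+∣p∩q∩r∣*2 (outside ∷ p) (_ ∷ q) (_ ∷ r) =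
  ∣p∩q∣+∣p∩r∣≡∣p∩[q⊝r]∣+∣p∩q∩r∣*2 p q r

odd+odd≢1+k*2 : ∀ a b k → a % 2 ≡ 1 → b % 2 ≡ 1 → a + b ≢ 1 + k * 2
odd+odd≢1+k*2 a b k a-odd b-odd a+b≡1+k*2 = ℕ.0≢1+n (begin
  0                     ≡⟨ cong₂ (λ x y → (x + y) % 2) a-odd b-odd ⟨
  (a % 2 + b % 2) % 2   ≡⟨ %-distribˡ-+ a b 2 ⟨
  (a + b) % 2           ≡⟨ cong (_% 2) a+b≡1+k*2 ⟩
  (1 + k * 2) % 2       ≡⟨ [m+kn]%n≡m%n 1 k 2 ⟩
  1                     ∎)
  where open ≡-Reasoning

odd-not-adjacent : ∀ (E : Fin n → Fin n → Set) (X : Subset n) {A B} →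
                   (∀ {u v} → E u v → ∣ X ∩ (⁅ u ⁆ ∪ ⁅ v ⁆) ∣ ≡ 1) →
                   ∣ X ∩ A ∣ % 2 ≡ 1 → ∣ X ∩ B ∣ % 2 ≡ 1 → ¬ TokenAdj E A B
odd-not-adjacent E X {A} {B} edge-crosses A-odd B-odd (u , v , uv∈E , A⊝B≡uv) =
  odd+odd≢1+k*2 (∣ X ∩ A ∣) (∣ X ∩ B ∣) (∣ X ∩ (A ∩ B) ∣) A-odd B-odd (begin
    ∣ X ∩ A ∣ + ∣ X ∩ B ∣                         ≡⟨ ∣p∩q∣+∣p∩r∣≡∣p∩[q⊝r]∣+∣p∩q∩r∣*2 X A B ⟩
    ∣ X ∩ (A ⊝ B) ∣ + ∣ X ∩ (A ∩ B) ∣ * 2         ≡⟨ cong (λ C → ∣ X ∩ C ∣ + ∣ X ∩ (A ∩ B) ∣ * 2) A⊝B≡uv ⟩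
    ∣ X ∩ (⁅ u ⁆ ∪ ⁅ v ⁆) ∣ + ∣ X ∩ (A ∩ B) ∣ * 2 ≡⟨ cong (_+ ∣ X ∩ (A ∩ B) ∣ * 2) (edge-crosses uv∈E) ⟩
    1 + ∣ X ∩ (A ∩ B) ∣ * 2                       ∎)
  where open ≡-Reasoning

wlog-< : (P : Fin n → Fin n → Set) → (∀ {i j} → P j i → P i j) →
         (∀ {i j} → i Fin.< j → P i j) → ∀ {i j} → i ≢ j → P i j
wlog-< P P-sym P-< {i} {j} i≢j with <-cmp i j
... | tri< i<j _ _ = P-< i<j
... | tri≈ _ i≡j _ = ⊥-elim (i≢j i≡j)
... | tri> _ _ j<i = P-sym (P-< j<i)

module _ {A B : Set} where

  lookup-injective : ∀ {xs : List A} → Unique xs → ∀ {i j} → List.lookup xs i ≡ List.lookup xs j → i ≡ j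
  lookup-injective {_ ∷ _} _               {zero}  {zero}  _  = refl
  lookup-injective {_ ∷ _} (x∉xs ∷ _)      {zero}  {suc j} eq = ⊥-elim (All.lookup x∉xs (∈-lookup j) eq)
  lookup-injective {_ ∷ _} (x∉xs ∷ _)      {suc i} {zero}  eq = ⊥-elim (All.lookup x∉xs (∈-lookup i) (sym eq))
  lookup-injective {_ ∷ _} (_ ∷ xs-unique) {suc i} {suc j} eq = cong suc (lookup-injective xs-unique eq)

  length-≤-of-injection : ∀ {xs : List A} {ys : List B} → Unique xs →
    (f : ∀ {x} → x ∈ₗ xs → B) → (∀ {x} (x∈xs : x ∈ₗ xs) → f x∈xs ∈ₗ ys) →
    (∀ {x y} (x∈xs : x ∈ₗ xs) (y∈xs : y ∈ₗ xs) → f x∈xs ≡ f y∈xs → x ≡ y) →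
    length xs ≤ length ys
  length-≤-of-injection {xs} {ys} xs-unique f f∈ys f-injective = injective⇒≤ g-injective
    where
    g : Fin (length xs) → Fin (length ys)
    g i = Any.index (f∈ys (∈-lookup i))
    g-injective : ∀ {i j} → g i ≡ g j → i ≡ j
    g-injective {i} {j} gi≡gj = lookup-injective xs-unique (f-injective _ _ (begin
      f (∈-lookup i)        ≡⟨ lookup-index (f∈ys (∈-lookup i)) ⟩
      List.lookup ys (g i)  ≡⟨ cong (List.lookup ys) gi≡gj ⟩
      List.lookup ys (g j)  ≡⟨ lookup-index (f∈ys (∈-lookup j)) ⟨
      f (∈-lookup j)        ∎))
      where open ≡-Reasoning

∈-allSubsets : ∀ (p : Subset n) → p ∈ₗ allSubsets n
∈-allSubsets []                    = here refl
∈-allSubsets (inside ∷ p)          = ∈-++⁺ˡ (∈-map⁺ (inside ∷_) (∈-allSubsets p))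
∈-allSubsets {suc n} (outside ∷ p) = ∈-++⁺ʳ (map (inside ∷_) (allSubsets n)) (∈-map⁺ (outside ∷_) (∈-allSubsets p))

allSubsets-unique : ∀ n → Unique (allSubsets n)
allSubsets-unique zero    = [] ∷ []
allSubsets-unique (suc n) = Unique.++⁺ (Unique.map⁺ ∷-injectiveʳ (allSubsets-unique n))
                                       (Unique.map⁺ ∷-injectiveʳ (allSubsets-unique n)) disjoint
  where
  disjoint : ∀ {p} → ¬ (p ∈ₗ map (inside ∷_) (allSubsets n) × p ∈ₗ map (outside ∷_) (allSubsets n))
  disjoint (p∈ , p∈′) with ∈-map⁻ (inside ∷_) p∈ | ∈-map⁻ (outside ∷_) p∈′
  ... | _ , _ , refl | _ , _ , ()

module GadgetGraph (m s : ℕ) (φ : TwoSubset s → Fin m)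
                   (φ-injective : ∀ P Q → φ P ≡ φ Q → proj₁ P ≡ proj₁ Q) where

  open Construction m s φ

  data Vertex : Set where
    blue : Fin m → Vertex
    red  : Fin m ⊎ Fin s → Vertex

  pattern redˡ i = red (inj₁ i)
  pattern redʰ k = red (inj₂ k)

  -- ⟦ redˡ i ⟧ and ⟦ redʰ k ⟧ are rlow i and rhigh k by computation.
  ⟦_⟧ : Vertex → Fin N
  ⟦ blue i ⟧ = b i
  ⟦ red c ⟧  = r (join m s c)

  decode : Fin N → Vertex
  decode v = [ blue , red ∘ splitAt m ]′ (splitAt m v)

  decode-⟦⟧ : ∀ x → decode ⟦ x ⟧ ≡ x
  decode-⟦⟧ (blue i) rewrite splitAt-↑ˡ m i (m + s) = refl
  decode-⟦⟧ (red c)  rewrite splitAt-↑ʳ m (m + s) (join m s c) | splitAt-join m s c = refl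

  ⟦⟧-decode : ∀ v → ⟦ decode v ⟧ ≡ v
  ⟦⟧-decode v = trans (⟦⟧-[blue,red∘splitAt] (splitAt m v)) (join-splitAt m (m + s) v)
    where
    ⟦⟧-[blue,red∘splitAt] : ∀ w → ⟦ [ blue , red ∘ splitAt m ]′ w ⟧ ≡ join m (m + s) w
    ⟦⟧-[blue,red∘splitAt] (inj₁ i) = refl
    ⟦⟧-[blue,red∘splitAt] (inj₂ j) = cong r (join-splitAt m s j)

  ⟦⟧-injective : ∀ {x y} → ⟦ x ⟧ ≡ ⟦ y ⟧ → x ≡ y
  ⟦⟧-injective {x} {y} eq = trans (sym (decode-⟦⟧ x)) (trans (cong decode eq) (decode-⟦⟧ y))

  ⟦⟧-≢ : ∀ {x y} → x ≢ y → ⟦ x ⟧ ≢ ⟦ y ⟧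
  ⟦⟧-≢ x≢y = x≢y ∘ ⟦⟧-injective

  pair : Vertex → Vertex → Subset N
  pair x y = ⁅ ⟦ x ⟧ ⁆ ∪ ⁅ ⟦ y ⟧ ⁆

  pair-comm : ∀ x y → pair x y ≡ pair y x
  pair-comm x y = ∪-comm ⁅ ⟦ x ⟧ ⁆ ⁅ ⟦ y ⟧ ⁆

  ∣pair∣≡2 : ∀ {x y} → x ≢ y → ∣ pair x y ∣ ≡ 2
  ∣pair∣≡2 x≢y = ∣⁅x⁆∪⁅y⁆∣≡2 (⟦⟧-≢ x≢y)

  -- Rset tabulates a `with` on `toℕ v <? m`: abstracting that decision in the type of
  -- lookup∘tabulate is what lets the lookup compute.
  b∉Rset : ∀ i → b i ∉ Rset
  b∉Rset i b∈Rset with (lookup Rset (b i) ≡ _ ∋ lookup∘tabulate _ (b i))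
  ... | lookup≡ with toℕ (b i) ℕ.<? m
  ...   | yes _   = case trans (sym lookup≡) ([]=⇒lookup b∈Rset) of λ ()
  ...   | no  b≮m = b≮m (subst (_< m) (sym (toℕ-↑ˡ i (m + s))) (toℕ<n i))

  r∈Rset : ∀ j → r j ∈ Rset
  r∈Rset j with (lookup Rset (r j) ≡ _ ∋ lookup∘tabulate _ (r j))
  ... | lookup≡ with toℕ (r j) ℕ.<? m
  ...   | yes r<m = ⊥-elim (ℕ.<⇒≱ r<m (subst (m ≤_) (sym (toℕ-↑ʳ m j)) (ℕ.m≤m+n m _)))
  ...   | no  _   = lookup⇒[]= (r j) Rset lookup≡

  ∣Rset∩[⁅b⁆∪⁅r⁆]∣≡1 : ∀ i j → ∣ Rset ∩ (⁅ b i ⁆ ∪ ⁅ r j ⁆) ∣ ≡ 1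
  ∣Rset∩[⁅b⁆∪⁅r⁆]∣≡1 i j = trans (cong ∣_∣ (p∩[⁅x⁆∪⁅y⁆]≡⁅y⁆ (b∉Rset i) (r∈Rset j))) (∣⁅x⁆∣≡1 (r j))

  edge₀-crosses-Rset : ∀ {u v} → Edge₀ u v → ∣ Rset ∩ (⁅ u ⁆ ∪ ⁅ v ⁆) ∣ ≡ 1
  edge₀-crosses-Rset (matching i)   = ∣Rset∩[⁅b⁆∪⁅r⁆]∣≡1 i _
  edge₀-crosses-Rset (gadget P _ _) = ∣Rset∩[⁅b⁆∪⁅r⁆]∣≡1 (φ P) _

  edge-crosses-Rset : ∀ {u v} → Edge u v → ∣ Rset ∩ (⁅ u ⁆ ∪ ⁅ v ⁆) ∣ ≡ 1
  edge-crosses-Rset (inj₁ uv∈E₀) = edge₀-crosses-Rset uv∈E₀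
  edge-crosses-Rset {u} {v} (inj₂ vu∈E₀) =
    trans (cong (λ C → ∣ Rset ∩ C ∣) (∪-comm ⁅ u ⁆ ⁅ v ⁆)) (edge₀-crosses-Rset vu∈E₀)

  Odd : Set
  Odd = Fin m × (Fin m ⊎ Fin s)

  oddPair : Odd → Subset N
  oddPair (i , c) = pair (blue i) (red c)

  oddPair-injective : ∀ {o o′} → oddPair o ≡ oddPair o′ → o ≡ o′
  oddPair-injective {i , c} {i′ , c′} eq with ⁅x⁆∪⁅y⁆≡⁅u⁆∪⁅v⁆⁻ eq
  ... | inj₁ bi≡bi′ , inj₂ rc≡rc′
      with ⟦⟧-injective {blue i} {blue i′} bi≡bi′ | ⟦⟧-injective {red c} {red c′} rc≡rc′
  ...   | refl | refl = refl
  oddPair-injective {i , c} {i′ , c′} eq | inj₂ bi≡rc′ , _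
      with ⟦⟧-injective {blue i} {red c′} bi≡rc′
  ...   | ()
  oddPair-injective {i , c} {i′ , c′} eq | inj₁ _ , inj₁ rc≡bi′
      with ⟦⟧-injective {red c} {blue i′} rc≡bi′
  ...   | ()

  private
    𝓡? = λ (A : Subset N) → (∣ A ∣ ℕ.≟ 2) ×-dec (∣ Rset ∩ A ∣ % 2 ℕ.≟ 1)

  ∈𝓡⁻ : ∀ {A} → A ∈ₗ 𝓡 → ∣ A ∣ ≡ 2 × ∣ Rset ∩ A ∣ % 2 ≡ 1
  ∈𝓡⁻ = proj₂ ∘ ∈-filter⁻ 𝓡? {xs = allSubsets N}

  oddPair∈𝓡 : ∀ o → oddPair o ∈ₗ 𝓡
  oddPair∈𝓡 (i , c) = ∈-filter⁺ 𝓡? (∈-allSubsets _)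
    (∣pair∣≡2 {blue i} {red c} (λ ()) , cong (_% 2) (∣Rset∩[⁅b⁆∪⁅r⁆]∣≡1 i (join m s c)))

  𝓡-independent : Independent₂ Edge 𝓡
  𝓡-independent = All.tabulate (proj₁ ∘ ∈𝓡⁻)
                , Unique.filter⁺ 𝓡? (allSubsets-unique N)
                , λ A∈𝓡 B∈𝓡 → odd-not-adjacent Edge Rset edge-crosses-Rset
                                 (proj₂ (∈𝓡⁻ A∈𝓡)) (proj₂ (∈𝓡⁻ B∈𝓡))

  φ₂ : (k l : Fin s) → k Fin.< l → Fin m
  φ₂ k l k<l = φ (⁅ k ⁆ ∪ ⁅ l ⁆ , ∣⁅x⁆∪⁅y⁆∣≡2 (<⇒≢ k<l))

  φ₂-injective : ∀ {k l k′ l′} (k<l : k Fin.< l) (k′<l′ : k′ Fin.< l′) →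
                 φ₂ k l k<l ≡ φ₂ k′ l′ k′<l′ → k ≡ k′ × l ≡ l′
  φ₂-injective k<l k′<l′ eq = ⁅x⁆∪⁅y⁆-injective-< k<l k′<l′ (φ-injective _ _ eq)

  GadgetTop : Fin m → Fin s → Set
  GadgetTop x l = ∃ λ k → ∃ λ (k<l : k Fin.< l) → φ₂ k l k<l ≡ x

  gadgetTop? : ∀ x l → Dec (GadgetTop x l)
  gadgetTop? x l = any? below?
    where
    below? : ∀ k → Dec (∃ λ (k<l : k Fin.< l) → φ₂ k l k<l ≡ x)
    below? k with k Fin.<? l
    ... | no  k≮l = no (k≮l ∘ proj₁)
    ... | yes k<l with φ₂ k l k<l ≟ x
    ...   | yes eq = yes (k<l , eq)
    ...   | no  ne = no λ (k<l′ , eq) → ne (subst (λ p → φ₂ k l p ≡ x) (<-irrelevant k<l′ k<l) eq)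

  gadgetTop-unique : ∀ {x l l′} → GadgetTop x l → GadgetTop x l′ → l ≡ l′
  gadgetTop-unique (_ , k<l , φ₂≡x) (_ , k′<l′ , φ₂′≡x) =
    proj₂ (φ₂-injective k<l k′<l′ (trans φ₂≡x (sym φ₂′≡x)))

  data Even : Set where
    blue-blue : (i j : Fin m) → i Fin.< j → Even
    low-low   : (i j : Fin m) → i Fin.< j → Even
    low-high  : Fin m → Fin s → Even
    high-high : (k l : Fin s) → k Fin.< l → Even

  evenPair : Even → Subset N
  evenPair (blue-blue i j _) = pair (blue i) (blue j)
  evenPair (low-low i j _)   = pair (redˡ i) (redˡ j)
  evenPair (low-high x l)    = pair (redˡ x) (redʰ l)
  evenPair (high-high k l _) = pair (redʰ k) (redʰ l)

  matchLowHigh : ∀ x l → Dec (GadgetTop x l) → Odd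
  matchLowHigh x l (yes _) = x , inj₁ x
  matchLowHigh x l (no _)  = x , inj₂ l

  match : Even → Odd
  match (blue-blue i j _)   = j , inj₁ i
  match (low-low i j _)     = i , inj₁ j
  match (low-high x l)      = matchLowHigh x l (gadgetTop? x l)
  match (high-high k l k<l) = φ₂ k l k<l , inj₂ l

  Adj : Subset N → Subset N → Set
  Adj = TokenAdj Edge

  adjacent-sharing : ∀ x y z → Edge ⟦ x ⟧ ⟦ y ⟧ → x ≢ y → x ≢ z → y ≢ z → Adj (pair x z) (pair y z)
  adjacent-sharing _ _ _ xy∈E x≢y x≢z y≢z =
    _ , _ , xy∈E , [⁅x⁆∪⁅z⁆]⊝[⁅y⁆∪⁅z⁆]≡⁅x⁆∪⁅y⁆ (⟦⟧-≢ x≢y) (⟦⟧-≢ x≢z) (⟦⟧-≢ y≢z)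

  match-adjacent : ∀ e → Adj (evenPair e) (oddPair (match e))
  match-adjacent (blue-blue i j i<j) =
    subst (Adj _) (pair-comm (redˡ i) (blue j))
      (adjacent-sharing (blue i) (redˡ i) (blue j) (inj₁ (matching i))
        (λ ()) (λ { refl → <-irrefl refl i<j }) (λ ()))
  match-adjacent (low-low i j i<j) =
    adjacent-sharing (redˡ i) (blue i) (redˡ j) (inj₂ (matching i))
      (λ ()) (λ { refl → <-irrefl refl i<j }) (λ ())
  match-adjacent (low-high x l) with gadgetTop? x l
  ... | yes (k , k<l , refl) =
    subst (λ A → Adj A (pair (blue x) (redˡ x))) (pair-comm (redʰ l) (redˡ x))
      (adjacent-sharing (redʰ l) (blue x) (redˡ x) (inj₂ (gadget _ l (y∈⁅x⁆∪⁅y⁆ k l)))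
        (λ ()) (λ ()) (λ ()))
  ... | no _ =
    adjacent-sharing (redˡ x) (blue x) (redʰ l) (inj₂ (matching x)) (λ ()) (λ ()) (λ ())
  match-adjacent (high-high k l k<l) =
    adjacent-sharing (redʰ k) (blue (φ₂ k l k<l)) (redʰ l) (inj₂ (gadget _ k (x∈⁅x⁆∪⁅y⁆ k l)))
      (λ ()) (λ { refl → <-irrefl refl k<l }) (λ ())

  match-injective : ∀ e e′ → match e ≡ match e′ → evenPair e ≡ evenPair e′
  match-injective (blue-blue _ _ _)   (blue-blue _ _ _)   refl = refl
  match-injective (blue-blue _ _ i<j) (low-low _ _ j<i)   refl = ⊥-elim (<-asym i<j j<i)
  match-injective (blue-blue _ _ i<j) (low-high x l) eq with gadgetTop? x l | eq
  ... | yes _ | refl = ⊥-elim (<-irrefl refl i<j)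
  ... | no  _ | ()
  match-injective (blue-blue _ _ _)   (high-high _ _ _)   ()
  match-injective (low-low _ _ i<j)   (blue-blue _ _ j<i) refl = ⊥-elim (<-asym i<j j<i)
  match-injective (low-low _ _ _)     (low-low _ _ _)     refl = refl
  match-injective (low-low _ _ i<j)   (low-high x l) eq with gadgetTop? x l | eq
  ... | yes _ | refl = ⊥-elim (<-irrefl refl i<j)
  ... | no  _ | ()
  match-injective (low-low _ _ _)     (high-high _ _ _)   ()
  match-injective (low-high x l) (blue-blue _ _ i<j) eq with gadgetTop? x l | eq
  ... | yes _ | refl = ⊥-elim (<-irrefl refl i<j)
  ... | no  _ | ()
  match-injective (low-high x l) (low-low _ _ i<j) eq with gadgetTop? x l | eq
  ... | yes _ | refl = ⊥-elim (<-irrefl refl i<j)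
  ... | no  _ | ()
  match-injective (low-high x l) (low-high x′ l′) eq with gadgetTop? x l | gadgetTop? x′ l′ | eq
  ... | yes top | yes top′ | refl = cong (pair (redˡ x) ∘ redʰ) (gadgetTop-unique top top′)
  ... | no  _   | no  _    | refl = refl
  ... | yes _   | no  _    | ()
  ... | no  _   | yes _    | ()
  match-injective (low-high x l) (high-high k _ k<l) eq with gadgetTop? x l | eq
  ... | yes _    | ()
  ... | no  ¬top | refl = ⊥-elim (¬top (k , k<l , refl))
  match-injective (high-high _ _ _) (blue-blue _ _ _) ()
  match-injective (high-high _ _ _) (low-low _ _ _)   ()
  match-injective (high-high k _ k<l) (low-high x l) eq with gadgetTop? x l | eq
  ... | yes _    | ()
  ... | no  ¬top | refl = ⊥-elim (¬top (k , k<l , refl))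
  match-injective (high-high _ _ k<l) (high-high _ _ k′<l′) eq
    with φ₂-injective k<l k′<l′ (cong proj₁ eq)
  ... | refl , refl = refl

  data Shape : Subset N → Set where
    even : ∀ e → Shape (evenPair e)
    odd  : ∀ o → Shape (oddPair o)

  swap : ∀ x y → Shape (pair y x) → Shape (pair x y)
  swap x y = subst Shape (pair-comm y x)

  orderedPairShape : ∀ {n} (v : Fin n → Vertex) → (∀ {i j} → i Fin.< j → Shape (pair (v i) (v j))) →
                     ∀ {i j} → v i ≢ v j → Shape (pair (v i) (v j))
  orderedPairShape v shape-< vi≢vj =
    wlog-< (λ i j → Shape (pair (v i) (v j))) (λ {i} {j} → swap (v i) (v j)) shape-< (vi≢vj ∘ cong v)

  pairShape : ∀ x y → x ≢ y → Shape (pair x y)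
  pairShape (blue _) (blue _)   = orderedPairShape blue (even ∘ blue-blue _ _)
  pairShape (blue i) (red c)  _ = odd (i , c)
  pairShape (red c)  (blue i) _ = swap (red c) (blue i) (odd (i , c))
  pairShape (redˡ _) (redˡ _)   = orderedPairShape redˡ (even ∘ low-low _ _)
  pairShape (redˡ x) (redʰ l) _ = even (low-high x l)
  pairShape (redʰ l) (redˡ x) _ = swap (redʰ l) (redˡ x) (even (low-high x l))
  pairShape (redʰ _) (redʰ _)   = orderedPairShape redʰ (even ∘ high-high _ _)

  shape : ∀ A → ∣ A ∣ ≡ 2 → Shape A
  shape A ∣A∣≡2 with ∣p∣≡2⇒p≡⁅x⁆∪⁅y⁆ A ∣A∣≡2
  ... | u , v , u≢v , refl =
    subst Shape (cong₂ (λ u v → ⁅ u ⁆ ∪ ⁅ v ⁆) (⟦⟧-decode u) (⟦⟧-decode v))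
      (pairShape (decode u) (decode v) (λ du≡dv → u≢v (begin
        u                ≡⟨ ⟦⟧-decode u ⟨
        ⟦ decode u ⟧     ≡⟨ cong ⟦_⟧ du≡dv ⟩
        ⟦ decode v ⟧     ≡⟨ ⟦⟧-decode v ⟩
        v                ∎)))
    where open ≡-Reasoning

  partner : ∀ {A} → Shape A → Odd
  partner (even e) = match e
  partner (odd o)  = o

  partner-collision : ∀ {A B} (σ : Shape A) (τ : Shape B) → partner σ ≡ partner τ →
                      A ≡ B ⊎ Adj A B ⊎ Adj B A
  partner-collision (even e) (even e′) eq   = inj₁ (match-injective e e′ eq)
  partner-collision (even e) (odd _)   refl = inj₂ (inj₁ (match-adjacent e))
  partner-collision (odd _)  (even e)  refl = inj₂ (inj₂ (match-adjacent e))
  partner-collision (odd _)  (odd _)   refl = inj₁ refl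

  independent⇒length≤length𝓡 : ∀ I → Independent₂ Edge I → length I ≤ length 𝓡
  independent⇒length≤length𝓡 I (I-two , I-unique , I-independent) =
    length-≤-of-injection I-unique (oddPair ∘ partner ∘ σ) (oddPair∈𝓡 ∘ partner ∘ σ) injective
    where
    σ : ∀ {A} → A ∈ₗ I → Shape A
    σ A∈I = shape _ (All.lookup I-two A∈I)
    injective : ∀ {A B} (A∈I : A ∈ₗ I) (B∈I : B ∈ₗ I) →
                oddPair (partner (σ A∈I)) ≡ oddPair (partner (σ B∈I)) → A ≡ B
    injective A∈I B∈I eq with partner-collision (σ A∈I) (σ B∈I) (oddPair-injective eq)
    ... | inj₁ A≡B        = A≡B
    ... | inj₂ (inj₁ A~B) = ⊥-elim (I-independent A∈I B∈I A~B)
    ... | inj₂ (inj₂ B~A) = ⊥-elim (I-independent B∈I A∈I B~A)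

-- The bounds on m and s only guarantee that an injective φ exists; the proof uses nothing else.
lemma4p1 : (m s : ℕ) → 1 ≤ m → s * (s ∸ 1) < 2 * m →
    (φ : TwoSubset s → Fin m) → (∀ P Q → φ P ≡ φ Q → proj₁ P ≡ proj₁ Q) →
    IsIndependenceNumber₂ (Construction.Edge m s φ) (length (Construction.𝓡 m s φ))
lemma4p1 m s _ _ φ φ-injective = (𝓡 , 𝓡-independent , refl) , independent⇒length≤length𝓡
  where
  open Construction m s φ using (𝓡)
  open GadgetGraph m s φ φ-injective
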